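{- Let $D_0$ be a northeast diagram with super-standard labeling $\mathcal{L}_0$. Then a diagram $D$ lies in $\mathcal{P}(D_0)$ if and only if $D$ admits a northeast labeling $\mathcal{L}$ that is column-equivalent to $\mathcal{L}_0$.
   Context: A diagram is a finite subset of $\mathbb{N}\times\mathbb{N}$; $(r,c)$ is a cell in row $r$, column $c$, rows numbered bottom to top. A Kohnert move on $D$ takes the rightmost cell $(r,c)$ of some row and moves it to $(r',c)$, $r'$ the largest $1\le r'<r$ with $(r',c)\notin D$ (no move if none). $\mathcal{P}(D_0)$ is the set of diagrams obtainable from $D_0$ by finitely many Kohnert moves. $D$ is northeast if for all cells $(r_1,c_1),(r_2,c_2)\in D$, $(\max(r_1,r_2),\max(c_1,c_2))\in D$. A labeling of $D$ is a map $\mathcal{L}:D\to\mathbb{N}$; it is strict if labels strictly increase from bottom to top within each column; the super-standard labeling labels each cell by its row index. For a strict labeling, the column content is the sequence $(C_1,C_2,\dots)$ with $C_i$ the set of labels in column $i$; two labelings are column-equivalent if they have the same column content. A northeast labeling of $D$ is a labeling $\mathcal{L}$ such that: (1) $\mathcal{L}$ is strict; (2) each label in row $i$ is at least $i$; (3) if cell $x'$ is in a column strictly to the right of cell $x$ and $\mathcal{L}(x')<\mathcal{L}(x)$, then there is a cell $x''$ in the column of $x'$ with $\mathcal{L}(x'')=\mathcal{L}(x)$; (4) if $x'$ is in a column strictly to the right of $x$ and $\mathcal{L}(x')=\mathcal{L}(x)$, then $x'$ is weakly below $x$. -}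

module Defs where

open import Data.Nat using (ℕ; _≤_; _<_; _⊔_)
open import Data.Product using (_×_; _,_; proj₁; proj₂; ∃-syntax)
open import Data.Sum using (_⊎_)
open import Data.List using (List)
open import Data.List.Membership.Propositional using (_∈_; _∉_)
open import Relation.Binary.PropositionalEquality using (_≡_; _≢_)
open import Function.Bundles using (_⇔_)

-- A cell (r , c): row r (numbered bottom to top, from 1), column c (from 1).
Cell : Set
Cell = ℕ × ℕ

-- A diagram is a finite subset of ℕ × ℕ, represented by a list of cells;
-- only membership matters (order and repetitions are irrelevant).
Diagram : Set
Diagram = List Cell

-- cells have positive coordinates (ℕ = {1,2,...} in the paper)
IsDiagram : Diagram → Set
IsDiagram D = ∀ r c → (r , c) ∈ D → (1 ≤ r × 1 ≤ c)

_≈D_ : Diagram → Diagram → Set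
D ≈D E = ∀ x → (x ∈ D) ⇔ (x ∈ E)

record KohnertMove (D E : Diagram) : Set where
  field
    r c r' : ℕ
    cell∈      : (r , c) ∈ D
    rightmost  : ∀ c' → (r , c') ∈ D → c' ≤ c
    1≤r'       : 1 ≤ r'
    r'<r       : r' < r
    target∉    : (r' , c) ∉ D
    largest    : ∀ k → r' < k → k < r → (k , c) ∈ D
    result     : ∀ x → (x ∈ E) ⇔ ((x ∈ D × x ≢ (r , c)) ⊎ x ≡ (r' , c))

data KohnertReachable (D₀ : Diagram) : Diagram → Set where
  base : ∀ {D} → D ≈D D₀ → KohnertReachable D₀ D
  step : ∀ {D E} → KohnertReachable D₀ D → KohnertMove D E → KohnertReachable D₀ E

NortheastDiagram : Diagram → Set
NortheastDiagram D = ∀ r₁ c₁ r₂ c₂ → (r₁ , c₁) ∈ D → (r₂ , c₂) ∈ D →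
  (r₁ ⊔ r₂ , c₁ ⊔ c₂) ∈ D

-- A labeling of D: only its values on cells of D matter.
Labeling : Set
Labeling = Cell → ℕ

superStandard : Labeling
superStandard = proj₁

Strict : Diagram → Labeling → Set
Strict D L = ∀ r₁ r₂ c → (r₁ , c) ∈ D → (r₂ , c) ∈ D → r₁ < r₂ → L (r₁ , c) < L (r₂ , c)

InColumnContent : Diagram → Labeling → ℕ → ℕ → Set
InColumnContent D L c n = ∃[ r ] ((r , c) ∈ D × L (r , c) ≡ n)

ColumnEquivalent : Diagram → Labeling → Diagram → Labeling → Set
ColumnEquivalent D L D' L' = ∀ c n → InColumnContent D L c n ⇔ InColumnContent D' L' c n

record NortheastLabeling (D : Diagram) (L : Labeling) : Set where
  field
    strict : Strict D L
    rowBound : ∀ r c → (r , c) ∈ D → r ≤ L (r , c)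
    cond3 : ∀ r c r' c' → (r , c) ∈ D → (r' , c') ∈ D → c < c' →
      L (r' , c') < L (r , c) → ∃[ r'' ] ((r'' , c') ∈ D × L (r'' , c') ≡ L (r , c))
    cond4 : ∀ r c r' c' → (r , c) ∈ D → (r' , c') ∈ D → c < c' →
      L (r' , c') ≡ L (r , c) → r' ≤ r

-- Both directions move labels along a reindexing ρ of rows inside each column: a northeast
-- labeling of D pulls back to E along a surjective, row-increasing ρ, provided the row bound
-- and condition (4) survive; strictness, condition (3) and the column content come for free.
--
-- A Kohnert move slides a segment of one column down by one row, and the labels follow the
-- slide. Condition (4) survives because an equal label to the right of the moved column would,
-- by (3) and (4), have to climb row by row up to the row of the moved cell, where no cell lies
-- to its right.
--
-- Conversely, if a northeast labeling column-equivalent to the super-standard one of D₀ is not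
-- itself super-standard, take the first cell in reading order whose label exceeds its row. All
-- cells above it are labelled by their rows, which forces the cell above it to be empty and the
-- row above to end weakly left of it: raising it by one row yields a northeast labeling from
-- which a Kohnert move returns, and the total excess of labels over rows drops. Induction on
-- this excess ends at a super-standard labeling, whose column content is the diagram itself.

module Submission where

open import Defs
open import Data.Product using (_×_; ∃-syntax)
open import Function.Bundles using (_⇔_)

open import Level using (Level; 0ℓ)
open import Data.Nat using (ℕ; suc; z≤n; _≤_; _<_; _>_; _≮_; _∸_; _+_; s≤s; _≤‴_; ≤‴-refl; ≤‴-step; _≟_; _≤?_; _<?_)
open import Data.Nat.Properties
open import Algebra.Properties.CommutativeSemigroup +-commutativeSemigroup using (x∙yz≈y∙xz)
open import Data.Nat.Induction using (<-rec)
open import Data.Nat.ListAction using (sum)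
open import Data.Product using (_,_; proj₁; proj₂)
open import Data.Product.Properties using (≡-dec)
import Data.Product.Relation.Binary.Lex.Strict as Lex
open import Data.Sum using (_⊎_; inj₁; inj₂; reduce)
open import Data.Empty using (⊥; ⊥-elim)
open import Data.List using (List; []; _∷_; map; filter)
open import Data.List.Properties using (map-cong-local)
import Data.List.Relation.Unary.All as All
open import Data.List.Relation.Unary.Any using (here; there)
open import Data.List.Membership.Propositional using (_∈_; _∉_)
open import Data.List.Membership.Propositional.Properties using (∈-filter⁺; ∈-filter⁻)
open import Function.Base using (flip)
open import Function.Bundles using (mk⇔; module Equivalence)
import Function.Properties.Equivalence as ⇔
open import Relation.Binary.Core using (Rel)
open import Relation.Binary.Definitions using (Total; Transitive)
import Relation.Binary.Construct.Flip.EqAndOrd as Flip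
open import Relation.Binary.PropositionalEquality
open import Relation.Nullary using (Dec; yes; no; ¬_; ¬?)
open import Relation.Nullary.Decidable using (_×-dec_; decidable-stable)

open Equivalence using (to; from)

_≟ᶜ_ : (p q : Cell) → Dec (p ≡ q)
_≟ᶜ_ = ≡-dec _≟_ _≟_

columnEquivalent-trans : ∀ {A B C LA LB LC} → ColumnEquivalent A LA B LB →
  ColumnEquivalent B LB C LC → ColumnEquivalent A LA C LC
columnEquivalent-trans A~B B~C c n = ⇔.trans (A~B c n) (B~C c n)

≈D⇒columnEquivalent : ∀ {D E L} → D ≈D E → ColumnEquivalent D L E L
≈D⇒columnEquivalent D≈E c n = mk⇔
  (λ (r , m , eq) → r , to (D≈E _) m , eq)
  (λ (r , m , eq) → r , from (D≈E _) m , eq)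

northeast-resp-≈D : ∀ {D E} → D ≈D E → NortheastDiagram E → NortheastDiagram D
northeast-resp-≈D D≈E ne r₁ c₁ r₂ c₂ m₁ m₂ =
  from (D≈E _) (ne r₁ c₁ r₂ c₂ (to (D≈E _) m₁) (to (D≈E _) m₂))

strict-mono-≤ : ∀ {D L a₁ a₂ b} → Strict D L → (a₁ , b) ∈ D → (a₂ , b) ∈ D →
  a₁ ≤ a₂ → L (a₁ , b) ≤ L (a₂ , b)
strict-mono-≤ strict m₁ m₂ a₁≤a₂ with m≤n⇒m<n∨m≡n a₁≤a₂
... | inj₁ a₁<a₂ = <⇒≤ (strict _ _ _ m₁ m₂ a₁<a₂)
... | inj₂ refl = ≤-refl

superStandard-northeast : ∀ {D} → NortheastDiagram D → NortheastLabeling D superStandard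
superStandard-northeast ne = record
  { strict = λ _ _ _ _ _ r₁<r₂ → r₁<r₂
  ; rowBound = λ _ _ _ → ≤-refl
  ; cond3 = λ r c r' c' m m' c<c' r'<r → r ,
      subst₂ (λ u v → (u , v) ∈ _) (m≥n⇒m⊔n≡m (<⇒≤ r'<r)) (m≤n⇒m⊔n≡n (<⇒≤ c<c'))
        (ne r c r' c' m m') ,
      refl
  ; cond4 = λ _ _ _ _ _ _ _ → ≤-reflexive
  }

superStandard-columnEquivalent⇒≈D : ∀ {D E L} → (∀ {y} → y ∈ D → L y ≡ proj₁ y) →
  ColumnEquivalent D L E superStandard → D ≈D E
superStandard-columnEquivalent⇒≈D {D} {E} {L} fixed D~E (r , c) = mk⇔ D⊆E E⊆D
  where
  D⊆E : (r , c) ∈ D → (r , c) ∈ E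
  D⊆E m with to (D~E c r) (r , m , fixed m)
  ... | _ , m' , refl = m'
  E⊆D : (r , c) ∈ E → (r , c) ∈ D
  E⊆D m with from (D~E c r) (r , m , refl)
  ... | r' , m' , Lr'≡r = subst (λ k → (k , c) ∈ D) (trans (sym (fixed m')) Lr'≡r) m'

reindex : Labeling → (ℕ → ℕ → ℕ) → Labeling
reindex L ρ (k , b) = L (ρ k b , b)

record Reindexing (E D : Diagram) (L : Labeling) (ρ : ℕ → ℕ → ℕ) : Set where
  field
    ∈-image    : ∀ {k b} → (k , b) ∈ E → (ρ k b , b) ∈ D
    monotone   : ∀ {k₁ k₂ b} → (k₁ , b) ∈ E → (k₂ , b) ∈ E → k₁ < k₂ → ρ k₁ b < ρ k₂ b
    rowBound   : ∀ {k b} → (k , b) ∈ E → k ≤ L (ρ k b , b)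
    cond4      : ∀ r c r' c' → (r , c) ∈ E → (r' , c') ∈ E → c < c' →
                 reindex L ρ (r' , c') ≡ reindex L ρ (r , c) → r' ≤ r
    surjective : ∀ {k b} → (k , b) ∈ D → ∃[ k' ] ((k' , b) ∈ E × ρ k' b ≡ k)

module _ {E D L ρ} (R : Reindexing E D L ρ) where
  open Reindexing R

  reindex-columnEquivalent : ColumnEquivalent E (reindex L ρ) D L
  reindex-columnEquivalent c n = mk⇔
    (λ (k , m , eq) → ρ k c , ∈-image m , eq)
    (λ (k , m , eq) → let (k' , m' , ρk'≡k) = surjective m in
      k' , m' , trans (cong (λ r → L (r , c)) ρk'≡k) eq)

  reindex-northeast : NortheastLabeling D L → NortheastLabeling E (reindex L ρ)
  reindex-northeast NE = record
    { strict = λ _ _ _ m₁ m₂ k₁<k₂ → N.strict _ _ _ (∈-image m₁) (∈-image m₂) (monotone m₁ m₂ k₁<k₂)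
    ; rowBound = λ _ _ → rowBound
    ; cond3 = cond3
    ; cond4 = cond4
    }
    where
    module N = NortheastLabeling NE
    cond3 : ∀ r c r' c' → (r , c) ∈ E → (r' , c') ∈ E → c < c' →
      reindex L ρ (r' , c') < reindex L ρ (r , c) →
      ∃[ r'' ] ((r'' , c') ∈ E × reindex L ρ (r'' , c') ≡ reindex L ρ (r , c))
    cond3 r c r' c' m m' c<c' lt with N.cond3 _ _ _ _ (∈-image m) (∈-image m') c<c' lt
    ... | _ , m'' , eq with surjective m''
    ... | k , mk , refl = k , mk , eq

-- The move slides the cells of column C in rows R' < k ≤ R down one row; ρ undoes the slide.
module MoveReindexing {D E : Diagram} {L : Labeling} (NE : NortheastLabeling D L)
  (mv : KohnertMove D E) where
  private
    module N = NortheastLabeling NE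
  open KohnertMove mv renaming (r to R; c to C; r' to R')

  Shifted : ℕ → ℕ → Set
  Shifted k b = b ≡ C × R' ≤ k × k < R

  shifted? : ∀ k b → Dec (Shifted k b)
  shifted? k b = (b ≟ C) ×-dec ((R' ≤? k) ×-dec (k <? R))

  ρ : ℕ → ℕ → ℕ
  ρ k b with shifted? k b
  ... | yes _ = suc k
  ... | no _ = k

  ρ-shifted : ∀ {k b} → Shifted k b → ρ k b ≡ suc k
  ρ-shifted {k} {b} s with shifted? k b
  ... | yes _ = refl
  ... | no unshifted = ⊥-elim (unshifted s)

  ρ-unshifted : ∀ {k b} → ¬ Shifted k b → ρ k b ≡ k
  ρ-unshifted {k} {b} ¬s with shifted? k b
  ... | yes s = ⊥-elim (¬s s)
  ... | no _ = refl

  segment∈D : ∀ {j} → R' < j → j ≤ R → (j , C) ∈ D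
  segment∈D {j} R'<j j≤R with m≤n⇒m<n∨m≡n j≤R
  ... | inj₁ j<R = largest j R'<j j<R
  ... | inj₂ refl = cell∈

  source∉E : (R , C) ∉ E
  source∉E m with to (result _) m
  ... | inj₁ (_ , ≢source) = ≢source refl
  ... | inj₂ eq = <-irrefl (sym (cong proj₁ eq)) r'<r

  noEqualLabelToTheRight : ∀ {j b} → R' < j → j ≤‴ R → C < b → (j , b) ∈ D →
    L (j , b) ≢ L (j , C)
  noEqualLabelToTheRight _ ≤‴-refl C<b m _ = <⇒≱ C<b (rightmost _ m)
  noEqualLabelToTheRight {j} {b} R'<j (≤‴-step j<‴R) C<b m eq =
    climb (N.cond3 (suc j) C j b above m C<b (subst (_< L (suc j , C)) (sym eq) below<above))
    where
    above : (suc j , C) ∈ D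
    above = segment∈D (m<n⇒m<1+n R'<j) (≤‴⇒≤ j<‴R)
    below<above : L (j , C) < L (suc j , C)
    below<above = N.strict _ _ _ (segment∈D R'<j (<⇒≤ (≤‴⇒≤ j<‴R))) above ≤-refl
    climb : ∃[ r ] ((r , b) ∈ D × L (r , b) ≡ L (suc j , C)) → ⊥
    climb (r , m' , eq') with m≤n⇒m<n∨m≡n (N.cond4 _ _ _ _ above m' C<b eq')
    ... | inj₂ refl = noEqualLabelToTheRight (m<n⇒m<1+n R'<j) j<‴R C<b m' eq'
    ... | inj₁ (s≤s r≤j) = <-irrefl refl (begin-strict
          L (r , b)       ≤⟨ strict-mono-≤ N.strict m' m r≤j ⟩
          L (j , b)       ≡⟨ eq ⟩
          L (j , C)       <⟨ below<above ⟩
          L (suc j , C)   ≡⟨ eq' ⟨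
          L (r , b)       ∎)
      where open ≤-Reasoning

  ∈-image : ∀ {k b} → (k , b) ∈ E → (ρ k b , b) ∈ D
  ∈-image {k} {b} m with shifted? k b
  ... | yes (refl , R'≤k , k<R) = segment∈D (s≤s R'≤k) k<R
  ... | no unshifted with to (result _) m
  ...   | inj₁ (m' , _) = m'
  ...   | inj₂ refl = ⊥-elim (unshifted (refl , ≤-refl , r'<r))

  monotone : ∀ {k₁ k₂ b} → (k₁ , b) ∈ E → (k₂ , b) ∈ E → k₁ < k₂ → ρ k₁ b < ρ k₂ b
  monotone {k₁} {k₂} {b} m₁ m₂ k₁<k₂ with shifted? k₁ b | shifted? k₂ b
  ... | yes _ | yes _ = s≤s k₁<k₂
  ... | no _  | yes _ = m<n⇒m<1+n k₁<k₂
  ... | no _  | no _  = k₁<k₂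
  ... | yes (refl , R'≤k₁ , k₁<R) | no unshifted =
    ≤-<-trans k₁<R (≤∧≢⇒< (≮⇒≥ k₂≮R) λ { refl → source∉E m₂ })
    where
    k₂≮R : k₂ ≮ R
    k₂≮R k₂<R = unshifted (refl , ≤-trans R'≤k₁ (<⇒≤ k₁<k₂) , k₂<R)

  rowBound : ∀ {k b} → (k , b) ∈ E → k ≤ L (ρ k b , b)
  rowBound {k} {b} m with shifted? k b | ∈-image m
  ... | yes _ | m' = ≤-trans (n≤1+n k) (N.rowBound _ _ m')
  ... | no _  | m' = N.rowBound _ _ m'

  cond4 : ∀ r c r' c' → (r , c) ∈ E → (r' , c') ∈ E → c < c' →
    reindex L ρ (r' , c') ≡ reindex L ρ (r , c) → r' ≤ r
  cond4 k₁ b₁ k₂ b₂ m₁ m₂ b₁<b₂ eq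
    with shifted? k₁ b₁ | shifted? k₂ b₂ | ∈-image m₁ | ∈-image m₂
  ... | yes (refl , _) | yes (refl , _) | _ | _ = ⊥-elim (<-irrefl refl b₁<b₂)
  ... | no _ | yes _ | m₁' | m₂' = ≤-trans (n≤1+n k₂) (N.cond4 _ _ _ _ m₁' m₂' b₁<b₂ eq)
  ... | no _ | no _  | m₁' | m₂' = N.cond4 _ _ _ _ m₁' m₂' b₁<b₂ eq
  ... | yes (refl , R'≤k₁ , k₁<R) | no _ | m₁' | m₂'
    with m≤n⇒m<n∨m≡n (N.cond4 _ _ _ _ m₁' m₂' b₁<b₂ eq)
  ...   | inj₁ (s≤s k₂≤k₁) = k₂≤k₁
  ...   | inj₂ refl = ⊥-elim (noEqualLabelToTheRight (s≤s R'≤k₁) (≤⇒≤‴ k₁<R) b₁<b₂ m₂' eq)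

  surjective : ∀ {k b} → (k , b) ∈ D → ∃[ k' ] ((k' , b) ∈ E × ρ k' b ≡ k)
  surjective {k} {b} m with (b ≟ C) ×-dec ((R' <? k) ×-dec (k ≤? R))
  ... | yes (refl , R'<k , k≤R) = preimage R'<k k≤R
    where
    preimage : ∀ {k} → R' < k → k ≤ R → ∃[ k' ] ((k' , C) ∈ E × ρ k' C ≡ k)
    preimage {suc k'} (s≤s R'≤k') k<R = k' , k'∈E , ρ-shifted (refl , R'≤k' , k<R)
      where
      k'∈E : (k' , C) ∈ E
      k'∈E with m≤n⇒m<n∨m≡n R'≤k'
      ... | inj₂ refl = from (result _) (inj₂ refl)
      ... | inj₁ R'<k' =
        from (result _) (inj₁ (largest k' R'<k' k<R , λ eq → <-irrefl (cong proj₁ eq) k<R))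
  ... | no outside = k , from (result _) (inj₁ (m , ≢source)) , ρ-unshifted unshifted
    where
    ≢source : (k , b) ≢ (R , C)
    ≢source refl = outside (refl , r'<r , ≤-refl)
    unshifted : ¬ Shifted k b
    unshifted (refl , R'≤k , k<R) with m≤n⇒m<n∨m≡n R'≤k
    ... | inj₁ R'<k = outside (refl , R'<k , <⇒≤ k<R)
    ... | inj₂ refl = target∉ m

  reindexing : Reindexing E D L ρ
  reindexing = record
    { ∈-image = ∈-image ; monotone = monotone ; rowBound = rowBound
    ; cond4 = cond4 ; surjective = surjective }

kohnertMove-northeastLabeling : ∀ {D E L} → NortheastLabeling D L → KohnertMove D E →
  ∃[ L' ] (NortheastLabeling E L' × ColumnEquivalent E L' D L)
kohnertMove-northeastLabeling {L = L} NE mv =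
  reindex L ρ , reindex-northeast reindexing NE , reindex-columnEquivalent reindexing
  where open MoveReindexing NE mv

module _ {a ℓ p : Level} {A : Set a} {_≼_ : Rel A ℓ} (≼-total : Total _≼_) (≼-trans : Transitive _≼_) where

  private
    ≼-refl : ∀ {x} → x ≼ x
    ≼-refl {x} = reduce (≼-total x x)

  least-satisfying : {P : A → Set p} → (∀ x → Dec (P x)) → (xs : List A) →
    (∀ {y} → y ∈ xs → ¬ P y) ⊎ ∃[ x ] (x ∈ xs × P x × (∀ {y} → y ∈ xs → P y → x ≼ y))
  least-satisfying P? [] = inj₁ λ ()
  least-satisfying P? (h ∷ t) with P? h | least-satisfying P? t
  ... | no ¬Ph | inj₁ none = inj₁ λ { (here refl) → ¬Ph ; (there m) → none m }
  ... | no ¬Ph | inj₂ (x , m , Px , least) =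
    inj₂ (x , there m , Px , λ { (here refl) Ph → ⊥-elim (¬Ph Ph) ; (there m') → least m' })
  ... | yes Ph | inj₁ none =
    inj₂ (h , here refl , Ph , λ { (here refl) _ → ≼-refl ; (there m) Py → ⊥-elim (none m Py) })
  ... | yes Ph | inj₂ (x , m , Px , least) with ≼-total h x
  ...   | inj₁ h≼x =
    inj₂ (h , here refl , Ph , λ { (here refl) _ → ≼-refl ; (there m') Py → ≼-trans h≼x (least m' Py) })
  ...   | inj₂ x≼h = inj₂ (x , there m , Px , λ { (here refl) _ → x≼h ; (there m') → least m' })

-- Reading order: higher rows first, and left to right within a row.
_≼_ : Rel Cell 0ℓ
_≼_ = Lex.×-Lex _≡_ _>_ _≤_

≼-total : Total _≼_
≼-total = Lex.×-total₂ sym (Flip.compare _<_ <-cmp) ≤-total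

≼-trans : Transitive _≼_
≼-trans = Lex.×-transitive {_<₁_ = _>_} {_<₂_ = _≤_}
  isEquivalence (Flip.resp₂ _<_ _≡_ (resp₂ _<_)) (flip <-trans) ≤-trans

remove : Cell → Diagram → Diagram
remove x = filter (λ y → ¬? (y ≟ᶜ x))

∈-remove⁺ : ∀ {x y xs} → y ∈ xs → y ≢ x → y ∈ remove x xs
∈-remove⁺ = ∈-filter⁺ _

∈-remove⁻ : ∀ {x y xs} → y ∈ remove x xs → y ∈ xs × y ≢ x
∈-remove⁻ = ∈-filter⁻ _

defect : Labeling → Cell → ℕ
defect L x = L x ∸ proj₁ x

totalDefect : Labeling → Diagram → ℕ
totalDefect L D = sum (map (defect L) D)

totalDefect-cong : ∀ {L L'} xs → (∀ {y} → y ∈ xs → L y ≡ L' y) → totalDefect L xs ≡ totalDefect L' xs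
totalDefect-cong xs eq = cong sum (map-cong-local (All.tabulate λ {y} m → cong (_∸ proj₁ y) (eq m)))

totalDefect-remove-≤ : ∀ L x xs → totalDefect L (remove x xs) ≤ totalDefect L xs
totalDefect-remove-≤ L x [] = ≤-refl
totalDefect-remove-≤ L x (y ∷ ys) with y ≟ᶜ x
... | yes _ = ≤-trans (totalDefect-remove-≤ L x ys) (m≤n+m _ _)
... | no _ = +-monoʳ-≤ (defect L y) (totalDefect-remove-≤ L x ys)

totalDefect-remove : ∀ L {x} xs → x ∈ xs → defect L x + totalDefect L (remove x xs) ≤ totalDefect L xs
totalDefect-remove L {x} (y ∷ ys) m with y ≟ᶜ x
totalDefect-remove L (y ∷ ys) m | yes refl = +-monoʳ-≤ (defect L y) (totalDefect-remove-≤ L y ys)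
totalDefect-remove L (y ∷ ys) (here refl) | no y≢x = ⊥-elim (y≢x refl)
totalDefect-remove L {x} (y ∷ ys) (there m) | no _ = begin
  defect L x + (defect L y + totalDefect L (remove x ys))  ≡⟨ x∙yz≈y∙xz (defect L x) (defect L y) _ ⟩
  defect L y + (defect L x + totalDefect L (remove x ys))  ≤⟨ +-monoʳ-≤ _ (totalDefect-remove L ys m) ⟩
  defect L y + totalDefect L ys                            ∎
  where open ≤-Reasoning

record Predecessor (D : Diagram) (L : Labeling) : Set where
  field
    D'               : Diagram
    L'               : Labeling
    isDiagram        : IsDiagram D'
    northeast        : NortheastLabeling D' L'
    columnEquivalent : ColumnEquivalent D' L' D L
    move             : KohnertMove D' D
    decreasing       : totalDefect L' D' < totalDefect L D

module InverseMove {D : Diagram} {L : Labeling} (NE : NortheastLabeling D L) (isD : IsDiagram D)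
  {a c : ℕ} (x∈D : (a , c) ∈ D) (unfixed : L (a , c) ≢ a)
  (first : ∀ {y} → y ∈ D → L y ≢ proj₁ y → (a , c) ≼ y) where
  private
    module N = NortheastLabeling NE

  ℓ : ℕ
  ℓ = L (a , c)

  a<ℓ : a < ℓ
  a<ℓ = ≤∧≢⇒< (N.rowBound a c x∈D) (λ a≡ℓ → unfixed (sym a≡ℓ))

  fixedAbove : ∀ {k b} → (k , b) ∈ D → a < k → L (k , b) ≡ k
  fixedAbove {k} {b} m a<k with L (k , b) ≟ k
  ... | yes eq = eq
  ... | no neq with first m neq
  ...   | inj₁ k<a = ⊥-elim (<-asym a<k k<a)
  ...   | inj₂ (refl , _) = ⊥-elim (<-irrefl refl a<k)

  above∉D : (suc a , c) ∉ D
  above∉D m = <⇒≱ a<ℓ (≤-pred (subst (ℓ <_) (fixedAbove m ≤-refl) (N.strict _ _ _ x∈D m ≤-refl)))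

  rightmostAbove : ∀ {c'} → (suc a , c') ∈ D → c' ≤ c
  rightmostAbove {c'} m with c' ≤? c
  ... | yes c'≤c = c'≤c
  ... | no c'≰c with m≤n⇒m<n∨m≡n (subst (_≤ ℓ) (sym (fixedAbove m ≤-refl)) a<ℓ)
  ...   | inj₂ eq = ⊥-elim (<-irrefl refl (N.cond4 a c (suc a) c' x∈D m (≰⇒> c'≰c) eq))
  ...   | inj₁ lt with N.cond3 a c (suc a) c' x∈D m (≰⇒> c'≰c) lt
  ...     | r , m' , Lr≡ℓ = ⊥-elim (<-irrefl refl (begin-strict
            ℓ                ≡⟨ Lr≡ℓ ⟨
            L (r , c')       <⟨ N.strict _ _ _ m' m (s≤s (N.cond4 a c r c' x∈D m' (≰⇒> c'≰c) Lr≡ℓ)) ⟩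
            L (suc a , c')   ≡⟨ fixedAbove m ≤-refl ⟩
            suc a            ≤⟨ a<ℓ ⟩
            ℓ                ∎))
    where open ≤-Reasoning

  D' : Diagram
  D' = (suc a , c) ∷ remove (a , c) D

  data View : Cell → Set where
    raised : View (suc a , c)
    kept   : ∀ {y} → y ∈ D → y ≢ (a , c) → View y

  view : ∀ {y} → y ∈ D' → View y
  view (here refl) = raised
  view (there m) = let (m' , ≢x) = ∈-remove⁻ m in kept m' ≢x

  ρ : ℕ → ℕ → ℕ
  ρ k b with (k , b) ≟ᶜ (suc a , c)
  ... | yes _ = a
  ... | no _ = k

  ρ-raised : ρ (suc a) c ≡ a
  ρ-raised with (suc a , c) ≟ᶜ (suc a , c)
  ... | yes _ = refl
  ... | no neq = ⊥-elim (neq refl)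

  ρ-kept : ∀ {k b} → (k , b) ∈ D → ρ k b ≡ k
  ρ-kept {k} {b} m with (k , b) ≟ᶜ (suc a , c)
  ... | yes refl = ⊥-elim (above∉D m)
  ... | no _ = refl

  ∈-image : ∀ {k b} → (k , b) ∈ D' → (ρ k b , b) ∈ D
  ∈-image m with view m
  ... | raised rewrite ρ-raised = x∈D
  ... | kept m' _ rewrite ρ-kept m' = m'

  monotone : ∀ {k₁ k₂ b} → (k₁ , b) ∈ D' → (k₂ , b) ∈ D' → k₁ < k₂ → ρ k₁ b < ρ k₂ b
  monotone m₁ m₂ k₁<k₂ with view m₁ | view m₂
  ... | raised | raised = ⊥-elim (<-irrefl refl k₁<k₂)
  ... | raised | kept n₂ _ rewrite ρ-raised | ρ-kept n₂ = <-trans (n<1+n a) k₁<k₂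
  ... | kept n₁ ≢x | raised rewrite ρ-raised | ρ-kept n₁ = ≤∧≢⇒< (≤-pred k₁<k₂) λ { refl → ≢x refl }
  ... | kept n₁ _ | kept n₂ _ rewrite ρ-kept n₁ | ρ-kept n₂ = k₁<k₂

  rowBound : ∀ {k b} → (k , b) ∈ D' → k ≤ L (ρ k b , b)
  rowBound m with view m
  ... | raised rewrite ρ-raised = a<ℓ
  ... | kept m' _ rewrite ρ-kept m' = N.rowBound _ _ m'

  cond4 : ∀ r c r' c' → (r , c) ∈ D' → (r' , c') ∈ D' → c < c' →
    reindex L ρ (r' , c') ≡ reindex L ρ (r , c) → r' ≤ r
  cond4 k₁ b₁ k₂ b₂ m₁ m₂ b₁<b₂ eq with view m₁ | view m₂
  ... | raised | raised = ⊥-elim (<-irrefl refl b₁<b₂)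
  ... | raised | kept n₂ _ rewrite ρ-raised | ρ-kept n₂ = m≤n⇒m≤1+n (N.cond4 a c k₂ b₂ x∈D n₂ b₁<b₂ eq)
  ... | kept n₁ _ | kept n₂ _ rewrite ρ-kept n₁ | ρ-kept n₂ = N.cond4 _ _ _ _ n₁ n₂ b₁<b₂ eq
  ... | kept n₁ _ | raised rewrite ρ-raised | ρ-kept n₁
    with m≤n⇒m<n∨m≡n (N.cond4 k₁ b₁ a c n₁ x∈D b₁<b₂ eq)
  ...   | inj₁ a<k₁ = a<k₁
  ...   | inj₂ refl with first n₁ (λ Lab₁≡a → unfixed (trans eq Lab₁≡a))
  ...     | inj₁ a<a = ⊥-elim (<-irrefl refl a<a)
  ...     | inj₂ (_ , c≤b₁) = ⊥-elim (<⇒≱ b₁<b₂ c≤b₁)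

  surjective : ∀ {k b} → (k , b) ∈ D → ∃[ k' ] ((k' , b) ∈ D' × ρ k' b ≡ k)
  surjective {k} {b} m with (k , b) ≟ᶜ (a , c)
  ... | yes refl = suc a , here refl , ρ-raised
  ... | no ≢x = k , there (∈-remove⁺ m ≢x) , ρ-kept m

  reindexing : Reindexing D' D L ρ
  reindexing = record
    { ∈-image = ∈-image ; monotone = monotone ; rowBound = rowBound
    ; cond4 = cond4 ; surjective = surjective }

  move : KohnertMove D' D
  move = record
    { r = suc a ; c = c ; r' = a
    ; cell∈ = here refl
    ; rightmost = λ c' m → rightmost (view m)
    ; 1≤r' = proj₁ (isD a c x∈D)
    ; r'<r = ≤-refl
    ; target∉ = λ m → target∉ (view m)
    ; largest = λ k a<k k<1+a → ⊥-elim (<⇒≱ a<k (≤-pred k<1+a))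
    ; result = λ y → mk⇔ (D⊆ y) (⊆D y)
    }
    where
    rightmost : ∀ {c'} → View (suc a , c') → c' ≤ c
    rightmost raised = ≤-refl
    rightmost (kept m _) = rightmostAbove m
    target∉ : ¬ View (a , c)
    target∉ (kept _ ≢x) = ≢x refl
    D⊆ : ∀ y → y ∈ D → (y ∈ D' × y ≢ (suc a , c)) ⊎ y ≡ (a , c)
    D⊆ y m with y ≟ᶜ (a , c)
    ... | yes y≡x = inj₂ y≡x
    ... | no ≢x = inj₁ (there (∈-remove⁺ m ≢x) , λ { refl → above∉D m })
    ⊆D : ∀ y → (y ∈ D' × y ≢ (suc a , c)) ⊎ y ≡ (a , c) → y ∈ D
    ⊆D y (inj₂ refl) = x∈D
    ⊆D y (inj₁ (m , ≢raised)) with view m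
    ... | raised = ⊥-elim (≢raised refl)
    ... | kept m' _ = m'

  isDiagram : IsDiagram D'
  isDiagram r c' m with view m
  ... | raised = s≤s z≤n , proj₂ (isD a c x∈D)
  ... | kept m' _ = isD r c' m'

  decreasing : totalDefect (reindex L ρ) D' < totalDefect L D
  decreasing = begin-strict
    totalDefect (reindex L ρ) D'
      ≡⟨ cong₂ _+_ (cong (λ r → L (r , c) ∸ suc a) ρ-raised)
                   (totalDefect-cong (remove (a , c) D) unchanged) ⟩
    (ℓ ∸ suc a) + totalDefect L (remove (a , c) D)  <⟨ +-monoˡ-< _ (∸-monoʳ-< ≤-refl a<ℓ) ⟩
    (ℓ ∸ a) + totalDefect L (remove (a , c) D)      ≤⟨ totalDefect-remove L D x∈D ⟩
    totalDefect L D                                 ∎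
    where
    open ≤-Reasoning
    unchanged : ∀ {y} → y ∈ remove (a , c) D → reindex L ρ y ≡ L y
    unchanged {k , b} m = cong (λ r → L (r , b)) (ρ-kept (proj₁ (∈-remove⁻ m)))

  predecessor : Predecessor D L
  predecessor = record
    { D' = D' ; L' = reindex L ρ ; isDiagram = isDiagram
    ; northeast = reindex-northeast reindexing NE
    ; columnEquivalent = reindex-columnEquivalent reindexing
    ; move = move ; decreasing = decreasing }

module _ {D₀ : Diagram} where

  reachable⇒northeastLabeling : NortheastDiagram D₀ → ∀ {D} → KohnertReachable D₀ D →
    ∃[ L ] (NortheastLabeling D L × ColumnEquivalent D L D₀ superStandard)
  reachable⇒northeastLabeling ne₀ (base D≈D₀) =
    superStandard , superStandard-northeast (northeast-resp-≈D D≈D₀ ne₀) , ≈D⇒columnEquivalent D≈D₀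
  reachable⇒northeastLabeling ne₀ (step r mv) with reachable⇒northeastLabeling ne₀ r
  ... | L , NE , D~D₀ with kohnertMove-northeastLabeling NE mv
  ...   | L' , NE' , E~D = L' , NE' , columnEquivalent-trans E~D D~D₀

  northeastLabeling⇒reachable : ∀ {D L} → IsDiagram D → NortheastLabeling D L →
    ColumnEquivalent D L D₀ superStandard → KohnertReachable D₀ D
  northeastLabeling⇒reachable {D} {L} = <-rec P induct (totalDefect L D) D L refl
    where
    P : ℕ → Set
    P n = ∀ D L → totalDefect L D ≡ n → IsDiagram D → NortheastLabeling D L →
      ColumnEquivalent D L D₀ superStandard → KohnertReachable D₀ D
    induct : ∀ n → (∀ {m} → m < n → P m) → P n
    induct _ rec D L refl isD NE D~D₀
      with least-satisfying ≼-total ≼-trans (λ y → ¬? (L y ≟ proj₁ y)) D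
    ... | inj₁ allFixed =
      base (superStandard-columnEquivalent⇒≈D (λ m → decidable-stable (L _ ≟ _) (allFixed m)) D~D₀)
    ... | inj₂ (_ , x∈D , unfixed , first) =
      step (rec decreasing D' L' refl isDiagram northeast D'~D₀) move
      where
      open Predecessor (InverseMove.predecessor NE isD x∈D unfixed first)
      D'~D₀ : ColumnEquivalent D' L' D₀ superStandard
      D'~D₀ = columnEquivalent-trans columnEquivalent D~D₀

theorem2p16 : (D₀ D : Diagram) → IsDiagram D₀ → IsDiagram D → NortheastDiagram D₀ →
    KohnertReachable D₀ D ⇔ (∃[ L ] (NortheastLabeling D L × ColumnEquivalent D L D₀ superStandard))
theorem2p16 D₀ D _ isD ne₀ = mk⇔ (reachable⇒northeastLabeling ne₀)
  λ (L , NE , D~D₀) → northeastLabeling⇒reachable isD NE D~D₀
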